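{- (1) For every Boolean function $f:\{0,1\}^n\to\{0,1\}$ and every bi-partition of $[n]$ into disjoint sets $S_1,S_2$ with $S_1\cup S_2=[n]$, $\mathsf{CC}(f)\le 2\cdot\mathsf{SubcubeDT}(f)\le 2\cdot\mathrm{D}(f)$. (2) For every Boolean function $f:\{0,1\}^n\to\{0,1\}$, $\mathrm{rank}(f)\le\mathsf{SubcubeDT}(f)\le\mathrm{rank}(f)\cdot(\log n+1)$.
   Context: Logarithms are base 2. Given a bi-partition $(S_1,S_2)$ of $[n]$, Alice holds the bits of $x$ indexed by $S_1$ and Bob those indexed by $S_2$; $\mathsf{CC}(f)$ is the minimum, over deterministic two-party protocols correctly computing $f$, of the maximum number of bits exchanged. $\mathrm{D}(f)$ is the minimum depth of a deterministic decision tree (each internal node queries one input bit and branches on its value; leaves labelled $0/1$) computing $f$. A subcube is a set $\{y\in\{0,1\}^n: y_i=a_i\ \forall i\in I\}$ for some $I\subseteq[n]$, $a\in\{0,1\}^I$. A subcube decision tree is like a decision tree but each internal node is labelled by a subcube $C$ and branches on whether $x\in C$; $\mathsf{SubcubeDT}(f)$ is the minimum depth of a subcube decision tree computing $f$. Rank of a decision tree: leaves have rank $0$; an internal node with children of ranks $r_1,r_2$ has rank $\max(r_1,r_2)$ if $r_1\ne r_2$ and $r_1+1$ if $r_1=r_2$; the tree's rank is its root's rank; $\mathrm{rank}(f)$ is the minimum rank of a (ordinary) decision tree computing $f$. -}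

module Defs where

open import Data.Nat using (ℕ; zero; suc; _+_; _⊔_; _≡ᵇ_)
open import Data.Bool using (Bool; true; false; _∧_; if_then_else_)
open import Data.Maybe using (Maybe; just; nothing)
open import Data.Fin using (Fin; zero; suc)
open import Data.Fin.Subset using (Subset; _∈_; ∁)
open import Relation.Binary.PropositionalEquality using (_≡_)

-- Inputs x ∈ {0,1}^n are functions Fin n → Bool (true = 1).
Input : ℕ → Set
Input n = Fin n → Bool

BoolFun : ℕ → Set
BoolFun n = Input n → Bool

data DT (n : ℕ) : Set where
  leaf  : Bool → DT n
  query : Fin n → DT n → DT n → DT n

evalDT : ∀ {n} → DT n → Input n → Bool
evalDT (leaf b)        x = b
evalDT (query i t₀ t₁) x = if x i then evalDT t₁ x else evalDT t₀ x

depthDT : ∀ {n} → DT n → ℕ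
depthDT (leaf _)        = 0
depthDT (query _ t₀ t₁) = suc (depthDT t₀ ⊔ depthDT t₁)

rankNode : ℕ → ℕ → ℕ
rankNode r₁ r₂ = if r₁ ≡ᵇ r₂ then suc r₁ else r₁ ⊔ r₂

rankDT : ∀ {n} → DT n → ℕ
rankDT (leaf _)        = 0
rankDT (query _ t₀ t₁) = rankNode (rankDT t₀) (rankDT t₁)

DTComputes : ∀ {n} → DT n → BoolFun n → Set
DTComputes t f = ∀ x → evalDT t x ≡ f x

-- A subcube {y : y_i = a_i ∀ i ∈ I}: C i = just a_i for i ∈ I, nothing for i ∉ I.
Subcube : ℕ → Set
Subcube n = Fin n → Maybe Bool

eqBool : Bool → Bool → Bool
eqBool true  true  = true
eqBool false false = true
eqBool _     _     = false

fits : Maybe Bool → Bool → Bool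
fits nothing  _ = true
fits (just a) b = eqBool a b

inCube : ∀ {n} → Subcube n → Input n → Bool
inCube {zero}  C x = true
inCube {suc n} C x = fits (C zero) (x zero) ∧ inCube (λ i → C (suc i)) (λ i → x (suc i))

data SDT (n : ℕ) : Set where
  leaf  : Bool → SDT n
  cube  : Subcube n → SDT n → SDT n → SDT n

evalSDT : ∀ {n} → SDT n → Input n → Bool
evalSDT (leaf b)       x = b
evalSDT (cube C t₀ t₁) x = if inCube C x then evalSDT t₁ x else evalSDT t₀ x

depthSDT : ∀ {n} → SDT n → ℕ
depthSDT (leaf _)       = 0
depthSDT (cube _ t₀ t₁) = suc (depthSDT t₀ ⊔ depthSDT t₁)

SDTComputes : ∀ {n} → SDT n → BoolFun n → Set
SDTComputes t f = ∀ x → evalSDT t x ≡ f x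

-- Each internal node is owned by one player and sends one bit computed
-- from that player's input (the history is encoded by the node's position).

AliceView : ∀ {n} → Subset n → Set
AliceView {n} S = (i : Fin n) → i ∈ S → Bool

BobView : ∀ {n} → Subset n → Set
BobView {n} S = (i : Fin n) → i ∈ ∁ S → Bool

data Protocol {n : ℕ} (S : Subset n) : Set where
  leaf  : Bool → Protocol S
  alice : (AliceView S → Bool) → Protocol S → Protocol S → Protocol S
  bob   : (BobView S → Bool) → Protocol S → Protocol S → Protocol S

runP : ∀ {n} {S : Subset n} → Protocol S → Input n → Bool
runP (leaf b)        x = b
runP (alice m p₀ p₁) x = if m (λ i _ → x i) then runP p₁ x else runP p₀ x
runP (bob m p₀ p₁)   x = if m (λ i _ → x i) then runP p₁ x else runP p₀ x

costP : ∀ {n} {S : Subset n} → Protocol S → ℕ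
costP (leaf _)        = 0
costP (alice _ p₀ p₁) = suc (costP p₀ ⊔ costP p₁)
costP (bob _ p₀ p₁)   = suc (costP p₀ ⊔ costP p₁)

PComputes : ∀ {n} {S : Subset n} → Protocol S → BoolFun n → Set
PComputes p f = ∀ x → runP p x ≡ f x

{-# OPTIONS --safe #-}
-- (1) Membership of x in a subcube is a conjunction over the coordinates, so it splits into
-- one bit computed by each player; a query of x_i is a query of the one-literal subcube.
-- (2) A subcube query unfolds into a path of literal queries whose off-path children are all
-- the same tree, which raises the rank by at most one. Conversely, follow the children of
-- rank r + 1 from the root of a tree of rank r + 1: the siblings left on the way have rank
-- at most r, and a coordinate already fixed on the path is never queried again, so the path
-- is a decision list with at most n exits. A binary search over it by subcube queries
-- ("does x pass the first k exits?") uses log n + 1 queries, after which a tree of rank r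
-- is left; hence 2 ^ depth ≤ (2n) ^ rank.

module Submission where

open import Defs
open import Data.Nat using (ℕ; zero; suc; _+_; _*_; _^_; _≤_; _<_; _⊔_; _≡ᵇ_; z≤n; s≤s; s≤s⁻¹; _<?_; _≤?_)
open import Data.Nat.Properties
open import Data.Bool using (Bool; true; false; _∧_; not; if_then_else_)
open import Data.Bool.Properties using (∧-assoc; ∧-comm; ∧-identityʳ; ∧-commutativeMonoid; if-∧; if-float; if-not)
open import Data.Maybe using (Maybe; just; nothing)
open import Data.Fin using (Fin; zero; suc)
open import Data.Fin.Subset using (Subset)
open import Data.Fin.Subset.Properties using (_∈?_; x∉p⇒x∈∁p)
open import Data.Vec.Functional using (tail; updateAt)
open import Data.List using (List; []; _∷_; _++_; length)
open import Data.List.Properties using (length-++)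
open import Data.List.Relation.Unary.All using (All; []; _∷_)
open import Data.List.Relation.Unary.All.Properties using (++⁻)
open import Data.Product using (Σ; _×_; _,_)
open import Data.Sum using (_⊎_; inj₁; inj₂)
open import Data.Unit using (⊤; tt)
open import Function using (_∘_; const; id)
open import Relation.Nullary using (Dec; yes; no; ¬_; contradiction)
open import Relation.Binary.PropositionalEquality
open import Algebra.Bundles using (CommutativeMonoid)
open import Algebra.Properties.CommutativeSemigroup
  (CommutativeMonoid.commutativeSemigroup ∧-commutativeMonoid) using (interchange)

∧-true⇒ˡ : ∀ a {b} → a ∧ b ≡ true → a ≡ true
∧-true⇒ˡ true eq = refl

∧-true⇒ʳ : ∀ a {b} → a ∧ b ≡ true → b ≡ true
∧-true⇒ʳ true eq = eq

eqBool-true⇒≡ : ∀ a b → eqBool a b ≡ true → b ≡ a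
eqBool-true⇒≡ true  true  _ = refl
eqBool-true⇒≡ false false _ = refl

eqBool-false⇒≡not : ∀ a b → eqBool a b ≡ false → b ≡ not a
eqBool-false⇒≡not true  false _ = refl
eqBool-false⇒≡not false true  _ = refl

eqBool-refl : ∀ b → eqBool b b ≡ true
eqBool-refl true  = refl
eqBool-refl false = refl

fullCube : ∀ {n} → Subcube n
fullCube _ = nothing

restrict : ∀ {n} → Subcube n → Fin n → Bool → Subcube n
restrict ρ i c = updateAt ρ i (const (just c))

dim : ∀ {n} → Subcube n → ℕ
dim {zero}  ρ = 0
dim {suc n} ρ with ρ zero
... | nothing = suc (dim (tail ρ))
... | just _  = dim (tail ρ)

dim-full : ∀ {n} → dim (fullCube {n}) ≡ n
dim-full {zero}  = refl
dim-full {suc n} = cong suc (dim-full {n})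

dim-restrict : ∀ {n} (ρ : Subcube n) i c → ρ i ≡ nothing → suc (dim (restrict ρ i c)) ≡ dim ρ
dim-restrict ρ zero    c ρi rewrite ρi = refl
dim-restrict ρ (suc i) c ρi with ρ zero
... | nothing = cong suc (dim-restrict (tail ρ) i c ρi)
... | just _  = dim-restrict (tail ρ) i c ρi

inCube-full : ∀ {n} (x : Input n) → inCube fullCube x ≡ true
inCube-full {zero}  x = refl
inCube-full {suc n} x = inCube-full (tail x)

inCube-restrict : ∀ {n} (ρ : Subcube n) i c (x : Input n) → ρ i ≡ nothing →
                  inCube (restrict ρ i c) x ≡ inCube ρ x ∧ eqBool c (x i)
inCube-restrict ρ zero    c x ρi rewrite ρi = ∧-comm (eqBool c (x zero)) _
inCube-restrict ρ (suc i) c x ρi =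
  trans (cong (fits (ρ zero) (x zero) ∧_) (inCube-restrict (tail ρ) i c (tail x) ρi))
        (sym (∧-assoc (fits (ρ zero) (x zero)) _ _))

inCube-fixed : ∀ {n} {ρ : Subcube n} {x : Input n} {b} i →
               inCube ρ x ≡ true → ρ i ≡ just b → x i ≡ b
inCube-fixed {ρ = ρ} {x} {b} zero x∈ρ ρi rewrite ρi =
  eqBool-true⇒≡ b (x zero) (∧-true⇒ˡ (eqBool b (x zero)) x∈ρ)
inCube-fixed {ρ = ρ} {x} (suc i) x∈ρ ρi =
  inCube-fixed {ρ = tail ρ} {tail x} i (∧-true⇒ʳ (fits (ρ zero) (x zero)) x∈ρ) ρi

inCube-literal : ∀ {n} (i : Fin n) (x : Input n) → inCube (restrict fullCube i true) x ≡ x i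
inCube-literal i x rewrite inCube-restrict fullCube i true x refl | inCube-full x with x i
... | true  = refl
... | false = refl

inCube-∧ : ∀ {n} (C : Subcube n) (x y z : Input n) →
           (∀ i → fits (C i) (x i) ≡ fits (C i) (y i) ∧ fits (C i) (z i)) →
           inCube C x ≡ inCube C y ∧ inCube C z
inCube-∧ {zero}  C x y z pw = refl
inCube-∧ {suc n} C x y z pw =
  trans (cong₂ _∧_ (pw zero) (inCube-∧ (tail C) (tail x) (tail y) (tail z) (pw ∘ suc)))
        (interchange (fits (C zero) (y zero)) (fits (C zero) (z zero)) _ _)

centre : Maybe Bool → Bool
centre (just b) = b
centre nothing  = true

fits-centre : ∀ a → fits a (centre a) ≡ true
fits-centre (just b) = eqBool-refl b
fits-centre nothing  = refl

glue : ∀ {P : Set} {A : Set} → Dec P → (P → A) → (¬ P → A) → A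
glue (yes p) f g = f p
glue (no ¬p) f g = g ¬p

fits-glue : ∀ {P : Set} a b (d : Dec P) →
            fits a b ≡ fits a (glue d (const b) (const (centre a))) ∧ fits a (glue d (const (centre a)) (const b))
fits-glue a b (yes _) = sym (trans (cong (fits a b ∧_) (fits-centre a)) (∧-identityʳ _))
fits-glue a b (no _) rewrite fits-centre a = refl

module _ {n : ℕ} (S : Subset n) where

  -- Each player completes her half of x by a point of C on the other half;
  -- x ∈ C iff both completions lie in C, since a subcube is a product of its coordinates.
  alicePart : Subcube n → AliceView S → Bool
  alicePart C v = inCube C (λ i → glue (i ∈? S) (v i) (const (centre (C i))))

  bobPart : Subcube n → BobView S → Bool
  bobPart C w = inCube C (λ i → glue (i ∈? S) (const (centre (C i))) (w i ∘ x∉p⇒x∈∁p))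

  inCube-split : ∀ C (x : Input n) → inCube C x ≡ alicePart C (λ i _ → x i) ∧ bobPart C (λ i _ → x i)
  inCube-split C x = inCube-∧ C x _ _ (λ i → fits-glue (C i) (x i) (i ∈? S))

  sdt⇒protocol : SDT n → Protocol S
  sdt⇒protocol (leaf b)       = leaf b
  sdt⇒protocol (cube C t₀ t₁) =
    alice (alicePart C) (sdt⇒protocol t₀) (bob (bobPart C) (sdt⇒protocol t₀) (sdt⇒protocol t₁))

  sdt⇒protocol-correct : ∀ t x → runP (sdt⇒protocol t) x ≡ evalSDT t x
  sdt⇒protocol-correct (leaf b)       x = refl
  sdt⇒protocol-correct (cube C t₀ t₁) x
    rewrite inCube-split C x | sdt⇒protocol-correct t₀ x | sdt⇒protocol-correct t₁ x
    = sym (if-∧ (alicePart C (λ i _ → x i)))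

  sdt⇒protocol-cost : ∀ t → costP (sdt⇒protocol t) ≤ 2 * depthSDT t
  sdt⇒protocol-cost (leaf b)       = z≤n
  sdt⇒protocol-cost (cube C t₀ t₁) = begin
    suc (a ⊔ suc (a ⊔ b))        ≡⟨ cong suc (m≤n⇒m⊔n≡n {a} (≤-trans (m≤m⊔n a b) (n≤1+n (a ⊔ b)))) ⟩
    suc (suc (a ⊔ b))            ≤⟨ s≤s (s≤s (⊔-mono-≤ (sdt⇒protocol-cost t₀) (sdt⇒protocol-cost t₁))) ⟩
    suc (suc (2 * d₀ ⊔ 2 * d₁))  ≡⟨ cong (2 +_) (sym (*-distribˡ-⊔ 2 d₀ d₁)) ⟩
    2 + 2 * (d₀ ⊔ d₁)            ≡⟨ sym (*-suc 2 (d₀ ⊔ d₁)) ⟩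
    2 * suc (d₀ ⊔ d₁)            ∎
    where
      open ≤-Reasoning
      a b d₀ d₁ : ℕ
      a = costP (sdt⇒protocol t₀)
      b = costP (sdt⇒protocol t₁)
      d₀ = depthSDT t₀
      d₁ = depthSDT t₁

dt⇒sdt : ∀ {n} → DT n → SDT n
dt⇒sdt (leaf b)        = leaf b
dt⇒sdt (query i t₀ t₁) = cube (restrict fullCube i true) (dt⇒sdt t₀) (dt⇒sdt t₁)

dt⇒sdt-correct : ∀ {n} (t : DT n) x → evalSDT (dt⇒sdt t) x ≡ evalDT t x
dt⇒sdt-correct (leaf b)        x = refl
dt⇒sdt-correct (query i t₀ t₁) x
  rewrite inCube-literal i x | dt⇒sdt-correct t₀ x | dt⇒sdt-correct t₁ x = refl

dt⇒sdt-depth : ∀ {n} (t : DT n) → depthSDT (dt⇒sdt t) ≡ depthDT t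
dt⇒sdt-depth (leaf b)        = refl
dt⇒sdt-depth (query i t₀ t₁) = cong suc (cong₂ _⊔_ (dt⇒sdt-depth t₀) (dt⇒sdt-depth t₁))

rankNode-diag : ∀ a → rankNode a a ≡ suc a
rankNode-diag a with a ≡ᵇ a | ≡⇒≡ᵇ a a refl
... | true  | _  = refl
... | false | ()

rankNode-≢ : ∀ {a b} → a ≢ b → rankNode a b ≡ a ⊔ b
rankNode-≢ {a} {b} a≢b with a ≡ᵇ b | ≡ᵇ⇒≡ a b
... | true  | a≡b = contradiction (a≡b _) a≢b
... | false | _   = refl

rankNode-≥ˡ : ∀ a b → a ≤ rankNode a b
rankNode-≥ˡ a b with a ≟ b
... | yes refl rewrite rankNode-diag a = n≤1+n a
... | no a≢b   rewrite rankNode-≢ a≢b  = m≤m⊔n a b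

rankNode-≥ʳ : ∀ a b → b ≤ rankNode a b
rankNode-≥ʳ a b with a ≟ b
... | yes refl rewrite rankNode-diag a = n≤1+n a
... | no a≢b   rewrite rankNode-≢ a≢b  = m≤n⊔m a b

rankNode-<ˡ : ∀ {a b c} → a < c → b ≤ c → rankNode a b ≤ c
rankNode-<ˡ {a} {b} a<c b≤c with a ≟ b
... | yes refl rewrite rankNode-diag a = a<c
... | no a≢b   rewrite rankNode-≢ a≢b  = ⊔-lub (<⇒≤ a<c) b≤c

rankNode-<ʳ : ∀ {a b c} → a ≤ c → b < c → rankNode a b ≤ c
rankNode-<ʳ {a} {b} a≤c b<c with a ≟ b
... | yes refl rewrite rankNode-diag a = b<c
... | no a≢b   rewrite rankNode-≢ a≢b  = ⊔-lub a≤c (<⇒≤ b<c)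

rankNode-pos : ∀ a b → 0 < rankNode a b
rankNode-pos a b with a ≟ b
... | yes refl rewrite rankNode-diag a = s≤s z≤n
... | no a≢b   rewrite rankNode-≢ a≢b  =
  n≢0⇒n>0 λ a⊔b≡0 → a≢b (trans (n≤0⇒n≡0 (subst (a ≤_) a⊔b≡0 (m≤m⊔n a b)))
                               (sym (n≤0⇒n≡0 (subst (b ≤_) a⊔b≡0 (m≤n⊔m a b)))))

rankNode-child : ∀ {a b r} → rankNode a b ≤ suc r → a ≤ r ⊎ b ≤ r
rankNode-child {a} {b} {r} rk with a ≟ b
... | yes refl rewrite rankNode-diag a = inj₁ (s≤s⁻¹ rk)
... | no a≢b   rewrite rankNode-≢ a≢b with a ≤? r
...   | yes a≤r = inj₁ a≤r
...   | no a≰r  = inj₂ (s≤s⁻¹ (≤∧≢⇒< b≤1+r λ b≡1+r → a≢b (trans a≡1+r (sym b≡1+r))))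
  where
    b≤1+r : b ≤ suc r
    b≤1+r = ≤-trans (m≤n⊔m a b) rk
    a≡1+r : a ≡ suc r
    a≡1+r = ≤-antisym (≤-trans (m≤m⊔n a b) rk) (≰⇒> a≰r)

-- Subcube queries as decision trees of small rank

literalDT : ∀ {n} → Maybe Bool → Fin n → DT n → DT n → DT n
literalDT nothing      i hit miss = hit
literalDT (just true)  i hit miss = query i miss hit
literalDT (just false) i hit miss = query i hit miss

literalDT-correct : ∀ {n} a (i : Fin n) hit miss x →
                    evalDT (literalDT a i hit miss) x ≡ (if fits a (x i) then evalDT hit x else evalDT miss x)
literalDT-correct nothing      i hit miss x = refl
literalDT-correct (just true)  i hit miss x with x i
... | true  = refl
... | false = refl
literalDT-correct (just false) i hit miss x with x i
... | true  = refl
... | false = refl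

literalDT-rank : ∀ {n c} a (i : Fin n) hit miss → rankDT miss < c → rankDT hit ≤ c →
                 rankDT (literalDT a i hit miss) ≤ c
literalDT-rank nothing      i hit miss miss<c hit≤c = hit≤c
literalDT-rank (just true)  i hit miss miss<c hit≤c = rankNode-<ˡ miss<c hit≤c
literalDT-rank (just false) i hit miss miss<c hit≤c = rankNode-<ʳ hit≤c miss<c

cubeDT : ∀ {m n} → (Fin m → Fin n) → Subcube m → DT n → DT n → DT n
cubeDT {zero}  e C hit miss = hit
cubeDT {suc m} e C hit miss = literalDT (C zero) (e zero) (cubeDT (e ∘ suc) (tail C) hit miss) miss

cubeDT-correct : ∀ {m n} (e : Fin m → Fin n) C hit miss x →
                 evalDT (cubeDT e C hit miss) x ≡ (if inCube C (x ∘ e) then evalDT hit x else evalDT miss x)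
cubeDT-correct {zero}  e C hit miss x = refl
cubeDT-correct {suc m} e C hit miss x = begin
  evalDT (literalDT (C zero) (e zero) (cubeDT (e ∘ suc) (tail C) hit miss) miss) x
    ≡⟨ literalDT-correct (C zero) (e zero) _ miss x ⟩
  (if fits (C zero) (x (e zero)) then evalDT (cubeDT (e ∘ suc) (tail C) hit miss) x else evalDT miss x)
    ≡⟨ cong (λ v → if fits (C zero) (x (e zero)) then v else evalDT miss x)
            (cubeDT-correct (e ∘ suc) (tail C) hit miss x) ⟩
  (if fits (C zero) (x (e zero))
     then (if inCube (tail C) (x ∘ e ∘ suc) then evalDT hit x else evalDT miss x)
     else evalDT miss x)
    ≡⟨ sym (if-∧ (fits (C zero) (x (e zero)))) ⟩
  (if inCube C (x ∘ e) then evalDT hit x else evalDT miss x) ∎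
  where open ≡-Reasoning

cubeDT-rank : ∀ {m n c} (e : Fin m → Fin n) C hit miss → rankDT miss < c → rankDT hit ≤ c →
              rankDT (cubeDT e C hit miss) ≤ c
cubeDT-rank {zero}  e C hit miss miss<c hit≤c = hit≤c
cubeDT-rank {suc m} e C hit miss miss<c hit≤c =
  literalDT-rank (C zero) (e zero) _ miss miss<c (cubeDT-rank (e ∘ suc) (tail C) hit miss miss<c hit≤c)

sdt⇒dt : ∀ {n} → SDT n → DT n
sdt⇒dt (leaf b)       = leaf b
sdt⇒dt (cube C t₀ t₁) = cubeDT id C (sdt⇒dt t₁) (sdt⇒dt t₀)

sdt⇒dt-correct : ∀ {n} (t : SDT n) x → evalDT (sdt⇒dt t) x ≡ evalSDT t x
sdt⇒dt-correct (leaf b)       x = refl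
sdt⇒dt-correct (cube C t₀ t₁) x
  rewrite cubeDT-correct id C (sdt⇒dt t₁) (sdt⇒dt t₀) x | sdt⇒dt-correct t₀ x | sdt⇒dt-correct t₁ x = refl

sdt⇒dt-rank : ∀ {n} (t : SDT n) → rankDT (sdt⇒dt t) ≤ depthSDT t
sdt⇒dt-rank (leaf b)       = z≤n
sdt⇒dt-rank (cube C t₀ t₁) =
  cubeDT-rank id C (sdt⇒dt t₁) (sdt⇒dt t₀)
    (s≤s (≤-trans (sdt⇒dt-rank t₀) (m≤m⊔n _ _)))
    (≤-trans (sdt⇒dt-rank t₁) (≤-trans (m≤n⊔m _ _) (n≤1+n _)))

-- exit i c S : continue while x i = c, otherwise answer with S.
record Exit (n : ℕ) : Set where
  constructor exit
  field
    var  : Fin n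
    stay : Bool
    tree : SDT n

evalDL : ∀ {n} → List (Exit n) → SDT n → Input n → Bool
evalDL []               F x = evalSDT F x
evalDL (exit i c S ∷ l) F x = if eqBool c (x i) then evalDL l F x else evalSDT S x

passes : ∀ {n} → List (Exit n) → Input n → Bool
passes []               x = true
passes (exit i c _ ∷ l) x = eqBool c (x i) ∧ passes l x

evalDL-pivot : ∀ {n} L i c S R F (x : Input n) →
               evalDL (L ++ exit i c S ∷ R) F x
                 ≡ (if passes L x ∧ eqBool c (x i) then evalDL R F x else evalDL L S x)
evalDL-pivot []                i c S R F x = refl
evalDL-pivot (exit j d T ∷ L) i c S R F x with eqBool d (x j)
... | true  = evalDL-pivot L i c S R F x
... | false = refl

passCube : ∀ {n} → Subcube n → List (Exit n) → Subcube n
passCube ρ []               = ρ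
passCube ρ (exit i c _ ∷ l) = passCube (restrict ρ i c) l

Fresh : ∀ {n} → Subcube n → List (Exit n) → Set
Fresh ρ []               = ⊤
Fresh ρ (exit i c _ ∷ l) = ρ i ≡ nothing × Fresh (restrict ρ i c) l

Fresh-++⁻ : ∀ {n} {ρ : Subcube n} L {R} → Fresh ρ (L ++ R) → Fresh ρ L × Fresh (passCube ρ L) R
Fresh-++⁻ []               fresh          = tt , fresh
Fresh-++⁻ (exit i c _ ∷ L) (free , fresh) with Fresh-++⁻ L fresh
... | freshL , freshR = (free , freshL) , freshR

Fresh-length : ∀ {n} {ρ : Subcube n} l → Fresh ρ l → length l ≤ dim ρ
Fresh-length []               _              = z≤n
Fresh-length {ρ = ρ} (exit i c _ ∷ l) (free , fresh) =
  ≤-trans (s≤s (Fresh-length l fresh)) (≤-reflexive (dim-restrict ρ i c free))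

inCube-passCube : ∀ {n} (ρ : Subcube n) l x → Fresh ρ l →
                  inCube (passCube ρ l) x ≡ inCube ρ x ∧ passes l x
inCube-passCube ρ []               x _              = sym (∧-identityʳ _)
inCube-passCube ρ (exit i c _ ∷ l) x (free , fresh) = begin
  inCube (passCube (restrict ρ i c) l) x          ≡⟨ inCube-passCube (restrict ρ i c) l x fresh ⟩
  inCube (restrict ρ i c) x ∧ passes l x          ≡⟨ cong (_∧ passes l x) (inCube-restrict ρ i c x free) ⟩
  (inCube ρ x ∧ eqBool c (x i)) ∧ passes l x      ≡⟨ ∧-assoc (inCube ρ x) _ _ ⟩
  inCube ρ x ∧ (eqBool c (x i) ∧ passes l x)      ∎
  where open ≡-Reasoning

pivot : ∀ {A : Set} (l : List A) k → k < length l →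
        Σ (List A) λ L → Σ A λ d → Σ (List A) λ R → l ≡ L ++ d ∷ R × length L ≡ k
pivot (a ∷ l) zero    _         = [] , a , l , refl , refl
pivot (a ∷ l) (suc k) (s≤s k<l) with pivot l k k<l
... | L , d , R , refl , refl = a ∷ L , d , R , refl , refl

image-⊔-≤ : ∀ (f : ℕ → ℕ) {a b B} → f a ≤ B → f b ≤ B → f (a ⊔ b) ≤ B
image-⊔-≤ f {a} {b} fa fb with ⊔-sel a b
... | inj₁ eq rewrite eq = fa
... | inj₂ eq rewrite eq = fb

module BinarySearch {n : ℕ} (M : ℕ) where

  Bounded : SDT n → Set
  Bounded t = 2 ^ depthSDT t ≤ M

  Realises : ℕ → Subcube n → List (Exit n) → SDT n → Set
  Realises B ρ l F =
    Σ (SDT n) λ t → (∀ x → inCube ρ x ≡ true → evalSDT t x ≡ evalDL l F x) × 2 ^ depthSDT t ≤ B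

  Searchable : ℕ → ℕ → Set
  Searchable p B = ∀ ρ l F → Fresh ρ l → length l < p →
                   All (Bounded ∘ Exit.tree) l → Bounded F → Realises B ρ l F

  searchable-mono : ∀ {p B B′} → B ≤ B′ → Searchable p B → Searchable p B′
  searchable-mono B≤B′ search ρ l F fresh len bounded bF with search ρ l F fresh len bounded bF
  ... | t , t-ok , t-bound = t , t-ok , ≤-trans t-bound B≤B′

  searchable-1 : Searchable 1 M
  searchable-1 ρ []      F _ _         _ bF = F , (λ _ _ → refl) , bF
  searchable-1 ρ (_ ∷ _) F _ (s≤s ()) _ _

  -- One subcube query asks whether x passes every exit up to the pivot; the answers
  -- leave the exits before the pivot (ending in the pivot's tree) or those after it.
  split-at-pivot : ∀ {p B} → Searchable p B → ∀ ρ L i c S R F → Fresh ρ (L ++ exit i c S ∷ R) →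
                   length L < p → length R < p → All (Bounded ∘ Exit.tree) (L ++ exit i c S ∷ R) →
                   Bounded F → Realises (2 * B) ρ (L ++ exit i c S ∷ R) F
  split-at-pivot search ρ L i c S R F fresh lenL lenR bounded bF
    with Fresh-++⁻ L fresh | ++⁻ L bounded
  ... | freshL , free , freshR | boundedL , bS ∷ boundedR
    with search ρ L S freshL lenL boundedL bS
       | search (restrict (passCube ρ L) i c) R F freshR lenR boundedR bF
  ... | tL , tL-ok , tL-bound | tR , tR-ok , tR-bound =
    cube σ tL tR , correct , *-monoʳ-≤ 2 (image-⊔-≤ (2 ^_) {depthSDT tL} {depthSDT tR} tL-bound tR-bound)
    where
      σ : Subcube n
      σ = restrict (passCube ρ L) i c

      σ-test : ∀ x → inCube ρ x ≡ true → inCube σ x ≡ passes L x ∧ eqBool c (x i)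
      σ-test x x∈ρ = begin
        inCube σ x                                  ≡⟨ inCube-restrict (passCube ρ L) i c x free ⟩
        inCube (passCube ρ L) x ∧ eqBool c (x i)    ≡⟨ cong (_∧ eqBool c (x i)) (inCube-passCube ρ L x freshL) ⟩
        (inCube ρ x ∧ passes L x) ∧ eqBool c (x i)  ≡⟨ cong (λ b → (b ∧ passes L x) ∧ eqBool c (x i)) x∈ρ ⟩
        passes L x ∧ eqBool c (x i)                 ∎
        where open ≡-Reasoning

      correct : ∀ x → inCube ρ x ≡ true → evalSDT (cube σ tL tR) x ≡ evalDL (L ++ exit i c S ∷ R) F x
      correct x x∈ρ rewrite evalDL-pivot L i c S R F x | sym (σ-test x x∈ρ) with inCube σ x in x∈σ
      ... | true  = tR-ok x x∈σ
      ... | false = tL-ok x x∈ρ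

  searchable-double : ∀ {p B} → Searchable p B → Searchable (2 * p) (2 * B)
  searchable-double {p} {B} search ρ l F fresh len bounded bF with length l <? p
  ... | yes short = searchable-mono (m≤m+n B (B + 0)) search ρ l F fresh short bounded bF
  searchable-double {suc k} search ρ l F fresh len bounded bF | no long
    with pivot l k (≮⇒≥ long)
  ... | L , exit i c S , R , refl , refl =
    split-at-pivot search ρ L i c S R F fresh ≤-refl lenR bounded bF
    where
      lenR : length R < suc (length L)
      lenR = +-cancelˡ-< (suc (length L)) (length R) (suc (length L)) (begin-strict
        suc (length L) + length R         ≡⟨ sym (+-suc (length L) (length R)) ⟩
        length L + suc (length R)         ≡⟨ sym (length-++ L) ⟩
        length (L ++ exit i c S ∷ R)      <⟨ len ⟩
        2 * suc (length L)                ≡⟨ cong (suc (length L) +_) (+-identityʳ (suc (length L))) ⟩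
        suc (length L) + suc (length L)   ∎)
        where open ≤-Reasoning

  searchable : ∀ h → Searchable (2 ^ h) (2 ^ h * M)
  searchable zero    = searchable-mono (≤-reflexive (sym (*-identityˡ M))) searchable-1
  searchable (suc h) =
    searchable-mono (≤-reflexive (sym (*-assoc 2 (2 ^ h) M))) (searchable-double (searchable h))

-- Subcube decision trees from decision trees of small rank

query-fixed : ∀ {n} {i : Fin n} {t₀ t₁ : DT n} {x : Input n} {b} →
              x i ≡ b → evalDT (query i t₀ t₁) x ≡ evalDT (if b then t₁ else t₀) x
query-fixed {x = x} {b} xi rewrite xi = sym (if-float (λ t → evalDT t x) b)

module Spines {n : ℕ} (M r : ℕ)
  (simulate : ∀ (T : DT n) → rankDT T ≤ r →
              Σ (SDT n) λ S → SDTComputes S (evalDT T) × 2 ^ depthSDT S ≤ M) where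

  open BinarySearch {n} M using (Bounded)

  record Spine (ρ : Subcube n) (T : DT n) : Set where
    constructor mkSpine
    field
      exits         : List (Exit n)
      final         : SDT n
      fresh         : Fresh ρ exits
      exits-bounded : All (Bounded ∘ Exit.tree) exits
      final-bounded : Bounded final
      correct       : ∀ x → inCube ρ x ≡ true → evalDL exits final x ≡ evalDT T x

  commit : ∀ {ρ i t₀ t₁} b → ρ i ≡ just b → Spine ρ (if b then t₁ else t₀) → Spine ρ (query i t₀ t₁)
  commit {i = i} b ρi (mkSpine exits final fresh exits-bounded final-bounded correct) =
    mkSpine exits final fresh exits-bounded final-bounded
      (λ x x∈ρ → trans (correct x x∈ρ) (sym (query-fixed (inCube-fixed i x∈ρ ρi))))

  branch : ∀ {ρ i t₀ t₁} c → ρ i ≡ nothing → rankDT (if c then t₀ else t₁) ≤ r →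
           Spine (restrict ρ i c) (if c then t₁ else t₀) → Spine ρ (query i t₀ t₁)
  branch {ρ} {i} {t₀} {t₁} c free exit-rank s with simulate (if c then t₀ else t₁) exit-rank
  ... | S , S-ok , S-bounded =
    mkSpine (exit i c S ∷ exits) final (free , fresh) (S-bounded ∷ exits-bounded) final-bounded correct′
    where
      open Spine s
      correct′ : ∀ x → inCube ρ x ≡ true → evalDL (exit i c S ∷ exits) final x ≡ evalDT (query i t₀ t₁) x
      correct′ x x∈ρ with eqBool c (x i) in test
      ... | true  = trans (correct x (trans (inCube-restrict ρ i c x free) (cong₂ _∧_ x∈ρ test)))
                          (sym (query-fixed (eqBool-true⇒≡ c (x i) test)))
      ... | false = trans (S-ok x)
                          (sym (trans (query-fixed (eqBool-false⇒≡not c (x i) test))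
                                      (cong (λ t → evalDT t x) (if-not c))))

  decompose : ∀ ρ T → rankDT T ≤ suc r → Spine ρ T
  decompose ρ (leaf b) _ with simulate (leaf b) z≤n
  ... | S , S-ok , S-bounded = mkSpine [] S tt [] S-bounded (λ x _ → S-ok x)
  decompose ρ (query i t₀ t₁) rk with ρ i in ρi
  ... | just false = commit false ρi (decompose ρ t₀ (≤-trans (rankNode-≥ˡ (rankDT t₀) (rankDT t₁)) rk))
  ... | just true  = commit true  ρi (decompose ρ t₁ (≤-trans (rankNode-≥ʳ (rankDT t₀) (rankDT t₁)) rk))
  ... | nothing with rankNode-child rk
  ...   | inj₁ t₀≤r = branch true  ρi t₀≤r
                        (decompose (restrict ρ i true)  t₁ (≤-trans (rankNode-≥ʳ (rankDT t₀) (rankDT t₁)) rk))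
  ...   | inj₂ t₁≤r = branch false ρi t₁≤r
                        (decompose (restrict ρ i false) t₀ (≤-trans (rankNode-≥ˡ (rankDT t₀) (rankDT t₁)) rk))

power-of-two-between : ∀ m → Σ ℕ λ h → suc m < 2 ^ h × 2 ^ h ≤ 2 * suc m
power-of-two-between zero = 1 , ≤-refl , ≤-refl
power-of-two-between (suc m) with power-of-two-between m
... | h , below , above with suc (suc m) <? 2 ^ h
...   | yes below′ = h , below′ , ≤-trans above (*-monoʳ-≤ 2 (n≤1+n (suc m)))
...   | no ¬below′ = suc h , subst (suc (suc m) <_) (cong (2 *_) (sym 2^h≡)) (m<m+n (suc (suc m)) (s≤s z≤n))
                           , ≤-reflexive (cong (2 *_) 2^h≡)
  where
    2^h≡ : 2 ^ h ≡ suc (suc m)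
    2^h≡ = ≤-antisym (≮⇒≥ ¬below′) below

rank-simulation⁺ : ∀ m r (T : DT (suc m)) → rankDT T ≤ r →
                   Σ (SDT (suc m)) λ t → SDTComputes t (evalDT T) × 2 ^ depthSDT t ≤ (2 * suc m) ^ r
rank-simulation⁺ m zero    (leaf b)        _  = leaf b , (λ _ → refl) , ≤-refl
rank-simulation⁺ m zero    (query i t₀ t₁) rk = contradiction rk (<⇒≱ (rankNode-pos (rankDT t₀) (rankDT t₁)))
rank-simulation⁺ m (suc r) T rk
  with power-of-two-between m | Spines.decompose ((2 * suc m) ^ r) r (rank-simulation⁺ m r) fullCube T rk
... | h , n<2^h , 2^h≤2n | Spines.mkSpine exits final fresh exits-bounded final-bounded correct
  with BinarySearch.searchable ((2 * suc m) ^ r) h fullCube exits final fresh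
         (≤-<-trans (subst (length exits ≤_) dim-full (Fresh-length exits fresh)) n<2^h)
         exits-bounded final-bounded
... | t , t-ok , t-bound =
  t , (λ x → trans (t-ok x (inCube-full x)) (correct x (inCube-full x)))
    , ≤-trans t-bound (*-monoˡ-≤ ((2 * suc m) ^ r) 2^h≤2n)

rank-simulation : ∀ {n} (T : DT n) →
                  Σ (SDT n) λ t → SDTComputes t (evalDT T) × 2 ^ depthSDT t ≤ (2 * n) ^ rankDT T
rank-simulation {zero}  (leaf b) = leaf b , (λ _ → refl) , ≤-refl
rank-simulation {suc m} T        = rank-simulation⁺ m (rankDT T) T ≤-refl

proposition3 :
    ((n : ℕ) (f : BoolFun n) (S : Subset n) →
       ((t : SDT n) → SDTComputes t f →
          Σ (Protocol S) (λ p → PComputes p f × costP p ≤ 2 * depthSDT t))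
       × ((t : DT n) → DTComputes t f →
          Σ (SDT n) (λ t′ → SDTComputes t′ f × 2 * depthSDT t′ ≤ 2 * depthDT t)))
    × ((n : ℕ) (f : BoolFun n) →
       ((t : SDT n) → SDTComputes t f →
          Σ (DT n) (λ t′ → DTComputes t′ f × rankDT t′ ≤ depthSDT t))
       × ((t : DT n) → DTComputes t f →
          Σ (SDT n) (λ t′ → SDTComputes t′ f × 2 ^ depthSDT t′ ≤ (2 * n) ^ rankDT t)))
proposition3 =
    (λ n f S →
        (λ t t-ok → sdt⇒protocol S t , (λ x → trans (sdt⇒protocol-correct S t x) (t-ok x))
                  , sdt⇒protocol-cost S t)
      , (λ t t-ok → dt⇒sdt t , (λ x → trans (dt⇒sdt-correct t x) (t-ok x))
                  , ≤-reflexive (cong (2 *_) (dt⇒sdt-depth t))))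
  , (λ n f →
        (λ t t-ok → sdt⇒dt t , (λ x → trans (sdt⇒dt-correct t x) (t-ok x)) , sdt⇒dt-rank t)
      , (λ t t-ok → let t′ , t′-ok , t′-bound = rank-simulation t
                    in t′ , (λ x → trans (t′-ok x) (t-ok x)) , t′-bound))
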